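{- Define polynomials $\lambda_{n,\nu}(x)$ for integers $n \geq 1$ and $\nu$ by: $\lambda_{1,1}(x) = 1$; $\lambda_{n,\nu}(x) = 0$ if $\nu < 1$ or $\nu > n$; and otherwise recursively \[ \lambda_{n+1,\nu}(x) = (x^2+x)\,\lambda_{n,\nu}'(x) + \lambda_{n,\nu-1}(x) + x\,\delta_{n,\nu}, \] where $\delta$ is the Kronecker delta. Let $\mathcal{S}_{ -1/2}$ be the set of polynomials $f$ with nonnegative integer coefficients satisfying $f(-\tfrac12 + x) = (-1)^{\deg f} f(-\tfrac12 - x)$ for all $x \in \mathbb{R}$. Then $\lambda_{n,\nu} \in \mathcal{S}_{ -1/2}$ for all $n \geq 3$ and $1 \leq \nu \leq n-2$.
   Formalization: The symmetry condition defining $\mathcal{S}_{ -1/2}$ is required only for rational x rather than for all $x \in \mathbb{R}$. -}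

module Defs where

open import Data.Nat using (ℕ; zero; suc; _*_)
import Data.Nat as ℕ
open import Data.Bool using (Bool; true; false; if_then_else_; _∧_)
open import Data.List using (List; []; _∷_)
open import Data.Integer using (+_)
open import Data.Rational using (ℚ; 1ℚ; _+_; _-_; -_; -½)
import Data.Rational as Q

-- Polynomials with nonnegative integer coefficients, as coefficient lists
-- (constant term first).  Trailing zeros are allowed; they do not change
-- the polynomial (evaluation and degree ignore them).
Poly : Set
Poly = List ℕ

_⊕_ : Poly → Poly → Poly
[]       ⊕ q        = q
p        ⊕ []       = p
(a ∷ p)  ⊕ (b ∷ q)  = (a ℕ.+ b) ∷ (p ⊕ q)

mulX : Poly → Poly
mulX []      = []
mulX (a ∷ p) = 0 ∷ a ∷ p

derivFrom : ℕ → Poly → Poly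
derivFrom k []      = []
derivFrom k (b ∷ p) = (k * b) ∷ derivFrom (suc k) p

deriv : Poly → Poly
deriv []      = []
deriv (a ∷ p) = derivFrom 1 p

X : Poly
X = 0 ∷ 1 ∷ []

-- Index ν ranges over ℕ; λ_{n,0} = 0 covers the case ν < 1
-- (all negative ν also give 0 and are never referenced except ν-1 = -1
-- when ν = 0).  λ_{0,ν} (n = 0) is not in the paper; set to 0.
-- For ν > n the recursion automatically yields the zero polynomial.
lam : ℕ → ℕ → Poly
lam zero _ = []
lam (suc zero) zero = []
lam (suc zero) (suc zero) = 1 ∷ []
lam (suc zero) (suc (suc _)) = []
lam (suc (suc n)) zero = []
lam (suc (suc n)) (suc ν) =
  ((mulX (mulX (deriv (lam (suc n) (suc ν)))) ⊕ mulX (deriv (lam (suc n) (suc ν))))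
     ⊕ lam (suc n) ν)
     ⊕ (if n ℕ.≡ᵇ ν then X else [])
  -- this is λ_{n+2,ν+1} = (x²+x) λ'_{n+1,ν+1} + λ_{n+1,ν} + x δ_{n+1,ν+1}

isZero : Poly → Bool
isZero []      = true
isZero (a ∷ p) = (a ℕ.≡ᵇ 0) ∧ isZero p

-- degree (highest index of a nonzero coefficient; 0 for the zero polynomial)
deg : Poly → ℕ
deg []      = 0
deg (a ∷ p) = if isZero p then 0 else suc (deg p)

eval : Poly → ℚ → ℚ
eval []      x = Q.0ℚ
eval (a ∷ p) x = ((+ a) Q./ 1) + x Q.* eval p x

sign : ℕ → ℚ
sign zero    = 1ℚ
sign (suc d) = - sign d

-- membership in S_{-1/2}: coefficients are nonnegative integers by
-- construction (ℕ), and f(-1/2 + x) = (-1)^{deg f} f(-1/2 - x) for all x.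
InS-½ : Poly → Set
InS-½ f = ∀ (x : ℚ) → eval f (-½ + x) ≡ sign (deg f) Q.* eval f (-½ - x)
  where open import Relation.Binary.PropositionalEquality using (_≡_)

module Submission where

-- Write  mirror x = -1 - x  for the reflection about -1/2 and
-- Dᵏ f for the k-th formal derivative.  Say that f is *s-symmetric* if
--      (Dᵏ f)(mirror x) = (-1)ᵏ s · (Dᵏ f)(x)     for all k and all x ∈ ℚ.
-- Carrying all derivatives along makes the notion closed under D (with s
-- replaced by -s) without any polynomial identity theorem.  It is also
-- closed under sums, contains the constants (s = 1), and is preserved by
-- multiplication with the symmetric factor x² + x: the proof is an
-- induction on k using the Leibniz rule D((x²+x) f) = (2x+1) f + (x²+x) Df
-- and the fact that multiplication by the antisymmetric factor 2x+1 turns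
-- s-symmetric polynomials into (-s)-symmetric ones.
-- The recurrence then shows by induction that λ_{n,ν} is (-1)^{n-ν}-symmetric
-- for 1 ≤ ν ≤ n-2 (the Kronecker term vanishes there, and the base case is
-- λ'_{n+1,n} = n, a constant).  Finally an s-symmetric f ≠ 0 has the nonzero
-- constant D^{deg f} f, whose symmetry forces s = (-1)^{deg f}; taking k = 0
-- at x = -1/2 - t gives membership in S_{-1/2}.

open import Defs
open import Data.Nat as ℕ using (ℕ; zero; suc; _≤_; _<_; _∸_; z≤n; s≤s)
import Data.Nat.Properties as ℕP
open import Data.Bool using (true; false; T)
open import Data.Unit using (tt)
open import Data.List using ([]; _∷_)
open import Data.Integer using (+_)
import Data.Integer as ℤ
import Data.Integer.Properties as ℤP
open import Data.Rational as Q using (ℚ; 1ℚ; 0ℚ; _+_; _*_; -_; -½)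
import Data.Rational.Properties as QP
import Data.Nat.Coprimality as Coprimality
open import Data.Product using (∃-syntax; _,_)
open import Data.Empty using (⊥-elim)
open import Level using (0ℓ)
open import Relation.Nullary.Decidable using (dec⇒maybe)
open import Relation.Binary.PropositionalEquality
open import Tactic.RingSolver using (solve-∀)
import Tactic.RingSolver.Core.AlmostCommutativeRing as ACR

open ≡-Reasoning

ℚ-ring : ACR.AlmostCommutativeRing 0ℓ 0ℓ
ℚ-ring = ACR.fromCommutativeRing QP.+-*-commutativeRing (λ x → dec⇒maybe (0ℚ QP.≟ x))

≡ᵇ-refl : ∀ n → (n ℕ.≡ᵇ n) ≡ true
≡ᵇ-refl zero    = refl
≡ᵇ-refl (suc n) = ≡ᵇ-refl n

≢⇒≡ᵇ-false : ∀ m n → m ≢ n → (m ℕ.≡ᵇ n) ≡ false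
≢⇒≡ᵇ-false m n m≢n with m ℕ.≡ᵇ n in eq
... | true  = ⊥-elim (m≢n (ℕP.≡ᵇ⇒≡ m n (subst T (sym eq) tt)))
... | false = refl

⊕-identityʳ : ∀ p → p ⊕ [] ≡ p
⊕-identityʳ []      = refl
⊕-identityʳ (a ∷ p) = refl

⊕-comm : ∀ p q → p ⊕ q ≡ q ⊕ p
⊕-comm []      []      = refl
⊕-comm []      (b ∷ q) = refl
⊕-comm (a ∷ p) []      = refl
⊕-comm (a ∷ p) (b ∷ q) = cong₂ _∷_ (ℕP.+-comm a b) (⊕-comm p q)

⊕-assoc : ∀ p q r → (p ⊕ q) ⊕ r ≡ p ⊕ (q ⊕ r)
⊕-assoc []      q       r       = refl
⊕-assoc (a ∷ p) []      r       = refl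
⊕-assoc (a ∷ p) (b ∷ q) []      = refl
⊕-assoc (a ∷ p) (b ∷ q) (c ∷ r) = cong₂ _∷_ (ℕP.+-assoc a b c) (⊕-assoc p q r)

⊕-interchange : ∀ p q r s → (p ⊕ q) ⊕ (r ⊕ s) ≡ (p ⊕ r) ⊕ (q ⊕ s)
⊕-interchange p q r s = begin
  (p ⊕ q) ⊕ (r ⊕ s)  ≡⟨ ⊕-assoc p q (r ⊕ s) ⟩
  p ⊕ (q ⊕ (r ⊕ s))  ≡⟨ cong (p ⊕_) (sym (⊕-assoc q r s)) ⟩
  p ⊕ ((q ⊕ r) ⊕ s)  ≡⟨ cong (λ t → p ⊕ (t ⊕ s)) (⊕-comm q r) ⟩
  p ⊕ ((r ⊕ q) ⊕ s)  ≡⟨ cong (p ⊕_) (⊕-assoc r q s) ⟩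
  p ⊕ (r ⊕ (q ⊕ s))  ≡⟨ sym (⊕-assoc p r (q ⊕ s)) ⟩
  (p ⊕ r) ⊕ (q ⊕ s)  ∎

mulX-⊕ : ∀ p q → mulX (p ⊕ q) ≡ mulX p ⊕ mulX q
mulX-⊕ []      q       = refl
mulX-⊕ (a ∷ p) []      = refl
mulX-⊕ (a ∷ p) (b ∷ q) = refl

derivFrom-⊕ : ∀ k p q → derivFrom k (p ⊕ q) ≡ derivFrom k p ⊕ derivFrom k q
derivFrom-⊕ k []      q       = refl
derivFrom-⊕ k (a ∷ p) []      = refl
derivFrom-⊕ k (a ∷ p) (b ∷ q) =
  cong₂ _∷_ (ℕP.*-distribˡ-+ k a b) (derivFrom-⊕ (suc k) p q)

deriv-⊕ : ∀ p q → deriv (p ⊕ q) ≡ deriv p ⊕ deriv q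
deriv-⊕ []      q       = refl
deriv-⊕ (a ∷ p) []      = sym (⊕-identityʳ _)
deriv-⊕ (a ∷ p) (b ∷ q) = derivFrom-⊕ 1 p q

deriv-mulX : ∀ p → deriv (mulX p) ≡ p ⊕ mulX (deriv p)
deriv-mulX []          = refl
deriv-mulX (a ∷ [])    = cong (_∷ []) (ℕP.*-identityˡ a)
deriv-mulX (a ∷ b ∷ p) = cong (1 ℕ.* a ∷_) (derivFrom-suc 1 (b ∷ p))
  where
  derivFrom-suc : ∀ k p → derivFrom (suc k) p ≡ p ⊕ derivFrom k p
  derivFrom-suc k []      = refl
  derivFrom-suc k (b ∷ p) = cong (_ ∷_) (derivFrom-suc (suc k) p)

D : ℕ → Poly → Poly
D zero    f = f
D (suc k) f = D k (deriv f)

D-⊕ : ∀ k p q → D k (p ⊕ q) ≡ D k p ⊕ D k q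
D-⊕ zero    p q = refl
D-⊕ (suc k) p q = trans (cong (D k) (deriv-⊕ p q)) (D-⊕ k (deriv p) (deriv q))

-- Multiplication by the symmetric factor x² + x = x(x+1) and by the
-- antisymmetric factor 2x + 1 (written as x f + f + x f).
W : Poly → Poly
W f = mulX (mulX f ⊕ f)

U : Poly → Poly
U f = (mulX f ⊕ f) ⊕ mulX f

deriv-W : ∀ f → deriv (W f) ≡ U f ⊕ W (deriv f)
deriv-W f = begin
  deriv (mulX (mulX f ⊕ f))                      ≡⟨ deriv-mulX (mulX f ⊕ f) ⟩
  (mulX f ⊕ f) ⊕ mulX (deriv (mulX f ⊕ f))       ≡⟨ cong (λ t → (mulX f ⊕ f) ⊕ mulX t) deriv-sum ⟩
  (mulX f ⊕ f) ⊕ mulX (f ⊕ (mulX f' ⊕ f'))       ≡⟨ cong ((mulX f ⊕ f) ⊕_) (mulX-⊕ f (mulX f' ⊕ f')) ⟩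
  (mulX f ⊕ f) ⊕ (mulX f ⊕ W f')                 ≡⟨ sym (⊕-assoc (mulX f ⊕ f) (mulX f) (W f')) ⟩
  U f ⊕ W f'                                     ∎
  where
  f' = deriv f
  deriv-sum : deriv (mulX f ⊕ f) ≡ f ⊕ (mulX f' ⊕ f')
  deriv-sum = begin
    deriv (mulX f ⊕ f)        ≡⟨ deriv-⊕ (mulX f) f ⟩
    deriv (mulX f) ⊕ f'       ≡⟨ cong (_⊕ f') (deriv-mulX f) ⟩
    (f ⊕ mulX f') ⊕ f'        ≡⟨ ⊕-assoc f (mulX f') f' ⟩
    f ⊕ (mulX f' ⊕ f')        ∎

deriv-U : ∀ f → deriv (U f) ≡ (f ⊕ f) ⊕ U (deriv f)
deriv-U f = begin
  deriv ((mulX f ⊕ f) ⊕ mulX f)                    ≡⟨ deriv-⊕ (mulX f ⊕ f) (mulX f) ⟩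
  deriv (mulX f ⊕ f) ⊕ deriv (mulX f)              ≡⟨ cong₂ _⊕_ (deriv-⊕ (mulX f) f) (deriv-mulX f) ⟩
  (deriv (mulX f) ⊕ f') ⊕ (f ⊕ mulX f')            ≡⟨ cong (λ t → (t ⊕ f') ⊕ (f ⊕ mulX f')) (deriv-mulX f) ⟩
  ((f ⊕ mulX f') ⊕ f') ⊕ (f ⊕ mulX f')             ≡⟨ cong (_⊕ (f ⊕ mulX f')) (⊕-assoc f (mulX f') f') ⟩
  (f ⊕ (mulX f' ⊕ f')) ⊕ (f ⊕ mulX f')             ≡⟨ ⊕-interchange f (mulX f' ⊕ f') f (mulX f') ⟩
  (f ⊕ f) ⊕ U f'                                   ∎
  where f' = deriv f

ι : ℕ → ℚ
ι a = (+ a) Q./ 1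

ι-+ : ∀ a b → ι (a ℕ.+ b) ≡ ι a + ι b
ι-+ a b = sym (begin
  ι a + ι b                                    ≡⟨ cong₂ _+_ (asFraction a) (asFraction b) ⟩
  (+ a ℤ.* + 1 ℤ.+ + b ℤ.* + 1) Q./ 1           ≡⟨ cong (Q._/ 1) (cong₂ ℤ._+_ (ℤP.*-identityʳ (+ a)) (ℤP.*-identityʳ (+ b))) ⟩
  ι (a ℕ.+ b)                                  ∎)
  where
  asFraction : ∀ a → ι a ≡ Q.mkℚ (+ a) 0 (Coprimality.sym (Coprimality.1-coprimeTo a))
  asFraction a = QP.normalize-coprime (Coprimality.sym (Coprimality.1-coprimeTo a))

eval-⊕ : ∀ p q y → eval (p ⊕ q) y ≡ eval p y + eval q y
eval-⊕ []      q       y = sym (QP.+-identityˡ _)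
eval-⊕ (a ∷ p) []      y = sym (QP.+-identityʳ _)
eval-⊕ (a ∷ p) (b ∷ q) y = begin
  ι (a ℕ.+ b) + y * eval (p ⊕ q) y              ≡⟨ cong₂ (λ u v → u + y * v) (ι-+ a b) (eval-⊕ p q y) ⟩
  (ι a + ι b) + y * (eval p y + eval q y)       ≡⟨ regroup (ι a) (ι b) y (eval p y) (eval q y) ⟩
  (ι a + y * eval p y) + (ι b + y * eval q y)   ∎
  where
  regroup : ∀ A B y P Q → (A + B) + y * (P + Q) ≡ (A + y * P) + (B + y * Q)
  regroup = solve-∀ ℚ-ring

eval-mulX : ∀ p y → eval (mulX p) y ≡ y * eval p y
eval-mulX []      y = sym (QP.*-zeroʳ y)
eval-mulX (a ∷ p) y = QP.+-identityˡ _

eval-W : ∀ f y → eval (W f) y ≡ y * (y * eval f y + eval f y)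
eval-W f y = begin
  eval (mulX (mulX f ⊕ f)) y     ≡⟨ eval-mulX (mulX f ⊕ f) y ⟩
  y * eval (mulX f ⊕ f) y        ≡⟨ cong (y *_) (eval-⊕ (mulX f) f y) ⟩
  y * (eval (mulX f) y + eval f y) ≡⟨ cong (λ t → y * (t + eval f y)) (eval-mulX f y) ⟩
  y * (y * eval f y + eval f y)  ∎

eval-U : ∀ f y → eval (U f) y ≡ (y * eval f y + eval f y) + y * eval f y
eval-U f y = begin
  eval ((mulX f ⊕ f) ⊕ mulX f) y                     ≡⟨ eval-⊕ (mulX f ⊕ f) (mulX f) y ⟩
  eval (mulX f ⊕ f) y + eval (mulX f) y              ≡⟨ cong₂ _+_ (eval-⊕ (mulX f) f y) (eval-mulX f y) ⟩
  (eval (mulX f) y + eval f y) + y * eval f y        ≡⟨ cong (λ t → (t + eval f y) + y * eval f y) (eval-mulX f y) ⟩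
  (y * eval f y + eval f y) + y * eval f y           ∎

-- The reflection x ↦ -1 - x, which fixes -1/2; S_{-1/2} consists of the
-- polynomials that are even or odd with respect to it.
mirror : ℚ → ℚ
mirror x = - 1ℚ + - x

-- g(mirror x) = s · g(x) for every x.  (A record, so that s and g can be
-- inferred from a proof.)
record Reflects (s : ℚ) (g : Poly) : Set where
  constructor reflects
  field at : ∀ x → eval g (mirror x) ≡ s * eval g x
open Reflects using (at)

Reflects-⊕ : ∀ {s f g} → Reflects s f → Reflects s g → Reflects s (f ⊕ g)
Reflects-⊕ {s} {f} {g} hf hg = reflects λ x → begin
  eval (f ⊕ g) (mirror x)                       ≡⟨ eval-⊕ f g (mirror x) ⟩
  eval f (mirror x) + eval g (mirror x)         ≡⟨ cong₂ _+_ (hf .at x) (hg .at x) ⟩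
  s * eval f x + s * eval g x                   ≡⟨ sym (QP.*-distribˡ-+ s _ _) ⟩
  s * (eval f x + eval g x)                     ≡⟨ cong (s *_) (sym (eval-⊕ f g x)) ⟩
  s * eval (f ⊕ g) x                            ∎

Reflects-D-⊕ : ∀ {s f g} k → Reflects s (D k f) → Reflects s (D k g) → Reflects s (D k (f ⊕ g))
Reflects-D-⊕ {s} {f} {g} k hf hg =
  subst (Reflects s) (sym (D-⊕ k f g)) (Reflects-⊕ hf hg)

-- x² + x is invariant under the reflection ...
mirror-square : ∀ s x F → (- 1ℚ + - x) * ((- 1ℚ + - x) * (s * F) + s * F) ≡ s * (x * (x * F + F))
mirror-square = solve-∀ ℚ-ring

Reflects-W : ∀ {s f} → Reflects s f → Reflects s (W f)
Reflects-W {s} {f} h = reflects λ x → begin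
  eval (W f) (mirror x)                                            ≡⟨ eval-W f (mirror x) ⟩
  mirror x * (mirror x * eval f (mirror x) + eval f (mirror x))    ≡⟨ cong (λ t → mirror x * (mirror x * t + t)) (h .at x) ⟩
  mirror x * (mirror x * (s * eval f x) + s * eval f x)            ≡⟨ mirror-square s x (eval f x) ⟩
  s * (x * (x * eval f x + eval f x))                              ≡⟨ cong (s *_) (sym (eval-W f x)) ⟩
  s * eval (W f) x                                                 ∎

-- ... while 2x + 1 changes sign.
mirror-linear : ∀ s x F → ((- 1ℚ + - x) * (s * F) + s * F) + (- 1ℚ + - x) * (s * F)
                          ≡ (- s) * ((x * F + F) + x * F)
mirror-linear = solve-∀ ℚ-ring

Reflects-U : ∀ {s f} → Reflects s f → Reflects (- s) (U f)
Reflects-U {s} {f} h = reflects λ x → begin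
  eval (U f) (mirror x)                                       ≡⟨ eval-U f (mirror x) ⟩
  (mirror x * eval f (mirror x) + eval f (mirror x))
    + mirror x * eval f (mirror x)                            ≡⟨ cong (λ t → (mirror x * t + t) + mirror x * t) (h .at x) ⟩
  (mirror x * (s * eval f x) + s * eval f x)
    + mirror x * (s * eval f x)                               ≡⟨ mirror-linear s x (eval f x) ⟩
  (- s) * ((x * eval f x + eval f x) + x * eval f x)          ≡⟨ cong (- s *_) (sym (eval-U f x)) ⟩
  (- s) * eval (U f) x                                        ∎

alternating : ℕ → ℚ → ℚ
alternating zero    s = s
alternating (suc k) s = alternating k (- s)

Symmetric : ℚ → Poly → Set
Symmetric s f = ∀ k → Reflects (alternating k s) (D k f)

Symmetric-deriv : ∀ {s f} → Symmetric s f → Symmetric (- s) (deriv f)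
Symmetric-deriv h k = h (suc k)

Symmetric-⊕ : ∀ {s f g} → Symmetric s f → Symmetric s g → Symmetric s (f ⊕ g)
Symmetric-⊕ hf hg k = Reflects-D-⊕ k (hf k) (hg k)

Symmetric-[] : ∀ {s} → Symmetric s []
Symmetric-[] {s} k = reflects λ x → begin
  eval (D k []) (mirror x)   ≡⟨ cong (λ p → eval p (mirror x)) (D-[] k) ⟩
  0ℚ                         ≡⟨ sym (QP.*-zeroʳ (alternating k s)) ⟩
  alternating k s * 0ℚ       ≡⟨ cong (λ p → alternating k s * eval p x) (sym (D-[] k)) ⟩
  alternating k s * eval (D k []) x ∎
  where
  D-[] : ∀ k → D k [] ≡ []
  D-[] zero    = refl
  D-[] (suc k) = D-[] k

Symmetric-const : ∀ c → Symmetric 1ℚ (c ∷ [])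
Symmetric-const c zero    = reflects λ x → constant (ι c) (mirror x) x
  where
  constant : ∀ A y x → A + y * 0ℚ ≡ 1ℚ * (A + x * 0ℚ)
  constant = solve-∀ ℚ-ring
Symmetric-const c (suc k) = Symmetric-[] k

-- needed since alternating k (- (- s)) and alternating k s differ definitionally
neg-involutive : ∀ s → - (- s) ≡ s
neg-involutive = solve-∀ ℚ-ring

Symmetric-U : ∀ {s f} → Symmetric s f → Symmetric (- s) (U f)
Symmetric-U h zero = Reflects-U (h zero)
Symmetric-U {s} {f} h (suc k) =
  subst (λ g → Reflects (alternating k (- (- s))) (D k g)) (sym (deriv-U f))
    (Reflects-D-⊕ k (Reflects-D-⊕ k hₖ hₖ) (Symmetric-U (Symmetric-deriv h) k))
  where
  hₖ : Reflects (alternating k (- (- s))) (D k f)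
  hₖ = subst (λ t → Reflects (alternating k t) (D k f)) (sym (neg-involutive s)) (h k)

Symmetric-W : ∀ {s f} → Symmetric s f → Symmetric s (W f)
Symmetric-W h zero = Reflects-W (h zero)
Symmetric-W {s} {f} h (suc k) =
  subst (λ g → Reflects (alternating k (- s)) (D k g)) (sym (deriv-W f))
    (Reflects-D-⊕ k (Symmetric-U h k) (Symmetric-W (Symmetric-deriv h) k))

lam-rec : ∀ n ν → n ≢ ν → lam (2 ℕ.+ n) (1 ℕ.+ ν) ≡ W (deriv (lam (1 ℕ.+ n) (1 ℕ.+ ν))) ⊕ lam (1 ℕ.+ n) ν
lam-rec n ν n≢ν rewrite ≢⇒≡ᵇ-false n ν n≢ν =
  trans (⊕-identityʳ _) (cong (_⊕ lam (suc n) ν) (sym (mulX-⊕ (mulX L′) L′)))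
  where L′ = deriv (lam (suc n) (suc ν))

lam-above : ∀ n ν → n < ν → lam n ν ≡ []
lam-above zero          ν             _         = refl
lam-above (suc zero)    (suc (suc ν)) _         = refl
lam-above (suc zero)    (suc zero)    (s≤s ())
lam-above (suc (suc n)) (suc ν)       (s≤s n<ν) = begin
  lam (2 ℕ.+ n) (1 ℕ.+ ν)                              ≡⟨ lam-rec n ν (ℕP.<⇒≢ (ℕP.<-trans (ℕP.n<1+n n) n<ν)) ⟩
  W (deriv (lam (1 ℕ.+ n) (1 ℕ.+ ν))) ⊕ lam (1 ℕ.+ n) ν ≡⟨ cong₂ (λ p q → W (deriv p) ⊕ q)
                                                              (lam-above (suc n) (suc ν) (ℕP.m≤n⇒m≤1+n n<ν))
                                                              (lam-above (suc n) ν n<ν) ⟩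
  []                                                   ∎

lam-diag : ∀ n → lam (suc n) (suc n) ≡ 1 ∷ []
lam-diag zero = refl
lam-diag (suc n) = begin
  lam (2 ℕ.+ n) (2 ℕ.+ n)                                      ≡⟨ lam-rec n (suc n) (ℕP.<⇒≢ (ℕP.n<1+n n)) ⟩
  W (deriv (lam (1 ℕ.+ n) (2 ℕ.+ n))) ⊕ lam (1 ℕ.+ n) (1 ℕ.+ n) ≡⟨ cong₂ (λ p q → W (deriv p) ⊕ q)
                                                                      (lam-above (suc n) (suc (suc n)) (ℕP.n<1+n (suc n)))
                                                                      (lam-diag n) ⟩
  1 ∷ []                                                       ∎

lam-subdiag : ∀ n → lam (2 ℕ.+ n) (1 ℕ.+ n) ≡ 0 ∷ suc n ∷ []
lam-subdiag zero = refl
lam-subdiag (suc n)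
  rewrite lam-diag (suc n) | lam-subdiag n | ≡ᵇ-refl n =
  cong (λ c → 0 ∷ c ∷ []) (ℕP.+-comm (suc n) 1)

-- λ_{m+a+3, a+1} is (-1)^m-symmetric.  The induction is on (m, a)
-- lexicographically: the derivative term lowers m, the second term lowers a.
mutual
  lam-symmetric : ∀ m a → Symmetric (sign m) (lam (3 ℕ.+ (m ℕ.+ a)) (1 ℕ.+ a))
  lam-symmetric m a =
    subst (Symmetric (sign m)) (sym (lam-rec (suc (m ℕ.+ a)) a off-diagonal))
      (Symmetric-⊕ (Symmetric-W (lam-deriv-symmetric m a)) (lam-lower-symmetric m a))
    where
    off-diagonal : suc (m ℕ.+ a) ≢ a
    off-diagonal = ℕP.>⇒≢ (s≤s (ℕP.m≤n+m a m))

  -- the derivative term λ'_{m+a+2, a+1}; for m = 0 it is the constant a + 1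
  lam-deriv-symmetric : ∀ m a → Symmetric (sign m) (deriv (lam (2 ℕ.+ (m ℕ.+ a)) (1 ℕ.+ a)))
  lam-deriv-symmetric zero    a rewrite lam-subdiag a = Symmetric-const (1 ℕ.* suc a)
  lam-deriv-symmetric (suc m) a = Symmetric-deriv (lam-symmetric m a)

  -- the second term λ_{m+a+2, a}; it vanishes for a = 0
  lam-lower-symmetric : ∀ m a → Symmetric (sign m) (lam (2 ℕ.+ (m ℕ.+ a)) a)
  lam-lower-symmetric m zero    = Symmetric-[]
  lam-lower-symmetric m (suc a) =
    subst (λ t → Symmetric (sign m) (lam (2 ℕ.+ t) (suc a))) (sym (ℕP.+-suc m a))
      (lam-symmetric m a)

-- From symmetry to S_{-1/2}: the sign is forced by the degree.

-- isZero and deg are unchanged by derivFrom (suc k), which multiplies each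
-- coefficient by a nonzero weight.
isZero-derivFrom : ∀ k p → isZero (derivFrom (suc k) p) ≡ isZero p
isZero-derivFrom k []          = refl
isZero-derivFrom k (zero ∷ p)  rewrite ℕP.*-zeroʳ k = isZero-derivFrom (suc k) p
isZero-derivFrom k (suc b ∷ p) = refl

deg-derivFrom : ∀ k p → deg (derivFrom (suc k) p) ≡ deg p
deg-derivFrom k []      = refl
deg-derivFrom k (b ∷ p) rewrite isZero-derivFrom (suc k) p | deg-derivFrom (suc k) p = refl

eval-isZero : ∀ p → isZero p ≡ true → ∀ y → eval p y ≡ 0ℚ
eval-isZero []         _    y = refl
eval-isZero (zero ∷ p) zero-p y = begin
  ι 0 + y * eval p y   ≡⟨ cong (λ t → ι 0 + y * t) (eval-isZero p zero-p y) ⟩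
  ι 0 + y * 0ℚ         ≡⟨ QP.+-identityˡ _ ⟩
  y * 0ℚ               ≡⟨ QP.*-zeroʳ y ⟩
  0ℚ                   ∎

top-derivative : ∀ d f → deg f ≡ d → isZero f ≡ false → ∃[ c ] (∀ y → eval (D d f) y ≡ ι (suc c))
top-derivative d       []      _  ()
top-derivative d       (a ∷ p) deg≡ nonzero with isZero p in zero-p
top-derivative zero    (zero ∷ p)  _    ()     | true
top-derivative zero    (suc c ∷ p) _    _      | true = c , λ y → begin
  ι (suc c) + y * eval p y   ≡⟨ cong (λ t → ι (suc c) + y * t) (eval-isZero p zero-p y) ⟩
  ι (suc c) + y * 0ℚ         ≡⟨ cong (λ t → ι (suc c) + t) (QP.*-zeroʳ y) ⟩
  ι (suc c) + 0ℚ             ≡⟨ QP.+-identityʳ _ ⟩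
  ι (suc c)                  ∎
top-derivative (suc d) (a ∷ p) ()   _      | true
top-derivative zero    (a ∷ p) ()   _      | false
top-derivative (suc d) (a ∷ p) deg≡ _      | false =
  top-derivative d (derivFrom 1 p)
    (trans (deg-derivFrom 0 p) (ℕP.suc-injective deg≡)) (trans (isZero-derivFrom 0 p) zero-p)

self-multiple : ∀ s v .{{_ : Q.NonZero v}} → v ≡ s * v → s ≡ 1ℚ
self-multiple s v v≡sv = begin
  s                   ≡⟨ sym (QP.*-identityʳ s) ⟩
  s * 1ℚ              ≡⟨ cong (s *_) (sym (QP.*-inverseʳ v)) ⟩
  s * (v * Q.1/ v)    ≡⟨ sym (QP.*-assoc s v (Q.1/ v)) ⟩
  (s * v) * Q.1/ v    ≡⟨ cong (_* Q.1/ v) (sym v≡sv) ⟩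
  v * Q.1/ v          ≡⟨ QP.*-inverseʳ v ⟩
  1ℚ                  ∎

ι-suc-nonZero : ∀ n → Q.NonZero (ι (suc n))
ι-suc-nonZero n = QP.pos⇒nonZero (ι (suc n)) {{QP.normalize-pos (suc n) 1}}

alternating-unit : ∀ k {s} → alternating k s ≡ 1ℚ → s ≡ sign k
alternating-unit zero    e = e
alternating-unit (suc k) {s} e = trans (sym (neg-involutive s)) (cong -_ (alternating-unit k e))

-- A nonzero s-symmetric polynomial has s = (-1)^{deg f}: compare the
-- constant D^{deg f} f at mirror 0 and at 0.
Symmetric-sign : ∀ {s f} → Symmetric s f → isZero f ≡ false → s ≡ sign (deg f)
Symmetric-sign {s} {f} h nonzero with top-derivative (deg f) f refl nonzero
... | c , top = alternating-unit (deg f)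
  (self-multiple _ (ι (suc c)) {{ι-suc-nonZero c}} (begin
    ι (suc c)                                   ≡⟨ sym (top (mirror 0ℚ)) ⟩
    eval (D (deg f) f) (mirror 0ℚ)              ≡⟨ h (deg f) .at 0ℚ ⟩
    alternating (deg f) s * eval (D (deg f) f) 0ℚ ≡⟨ cong (alternating (deg f) s *_) (top 0ℚ) ⟩
    alternating (deg f) s * ι (suc c)           ∎))

mirror-half : ∀ x → - 1ℚ + - (-½ + - x) ≡ -½ + x
mirror-half = solve-∀ ℚ-ring

-- Every symmetric polynomial lies in S_{-1/2}: use k = 0 at x = -1/2 - t,
-- with the sign identified by Symmetric-sign.
Symmetric⇒InS-½ : ∀ {s f} → Symmetric s f → InS-½ f
Symmetric⇒InS-½ {s} {f} h x with isZero f in zero-f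
... | true = trans (eval-isZero f zero-f _)
  (sym (trans (cong (sign (deg f) *_) (eval-isZero f zero-f _)) (QP.*-zeroʳ (sign (deg f)))))
... | false = begin
  eval f (-½ + x)                  ≡⟨ cong (eval f) (sym (mirror-half x)) ⟩
  eval f (mirror (-½ + - x))       ≡⟨ h 0 .at (-½ + - x) ⟩
  s * eval f (-½ + - x)            ≡⟨ cong (_* eval f (-½ + - x)) (Symmetric-sign h zero-f) ⟩
  sign (deg f) * eval f (-½ + - x) ∎

-- Proposition 2.3: with n = m + ν + 2 and ν = a + 1, λ_{n,ν} is
-- (-1)^m-symmetric, hence in S_{-1/2}.
proposition2p3 : ∀ (n ν : ℕ) → 3 ≤ n → 1 ≤ ν → ν ≤ n ∸ 2 → InS-½ (lam n ν)
proposition2p3 (suc (suc (suc n))) (suc a) (s≤s (s≤s (s≤s _))) (s≤s z≤n) (s≤s a≤n) =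
  Symmetric⇒InS-½
    (subst (λ t → Symmetric (sign (n ∸ a)) (lam (3 ℕ.+ t) (1 ℕ.+ a)))
      (ℕP.m∸n+n≡m a≤n) (lam-symmetric (n ∸ a) a))
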